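{- For all positive integers $k, t$, $\mathcal{L}(k,t) \geq \Omega\!\left(t+1, \lfloor k/2 \rfloor\right) - 1$.
   Context: A congruential $t$-power modulo $k$ is a word $x_1 x_2 \cdots x_t$ over the integers with $x_1,\ldots,x_t$ nonempty, $|x_1| = \cdots = |x_t|$, and $\sum x_1 \equiv \cdots \equiv \sum x_t \pmod{k}$ ($\sum x$ = sum of entries). $\mathcal{L}(k,t)$ is the minimum integer $n$ such that for every coloring $\chi:[1,n] \to \{0,1,\ldots,k-1\}$, the word $\chi(1)\chi(2)\cdots\chi(n)$ contains a congruential $t$-power modulo $k$ as a factor. For integers $m \ge 1$ and $k \ge 0$, $\Omega(m,k)$ is the smallest integer $n$ such that every set $\{x_1, \ldots, x_n\}$ of integers with $x_i \in [(i-1)k+1, ik]$ for each $i$ contains an $m$-term arithmetic progression (with positive common difference). -}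

module Defs where

open import Data.Nat using (ℕ; zero; suc; _+_; _*_; _∸_; _≤_; _<_)
open import Data.Fin using (Fin; toℕ)
open import Data.Integer using (ℤ; +_; _-_)
open import Data.Integer.Divisibility using (_∣_)
open import Data.Product using (Σ; ∃; _×_)
open import Relation.Binary.PropositionalEquality using (_≡_)

-- A colouring of the positive integers with colours {0,…,k-1};
-- only its values on [1,n] matter for colourings of [1,n].
Colouring : ℕ → Set
Colouring k = ℕ → Fin k

blockSum : ∀ {k} → Colouring k → ℕ → ℕ → ℕ
blockSum χ p zero    = 0
blockSum χ p (suc ℓ) = toℕ (χ (suc p)) + blockSum χ (suc p) ℓ

_≡_[mod_] : ℕ → ℕ → ℕ → Set
a ≡ b [mod k ] = (+ k) ∣ ((+ a) - (+ b))

-- The factor of χ(1)…χ(n) occupying positions s+1, …, s+t·ℓ, split into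
-- t blocks x_1,…,x_t of common length ℓ ≥ 1, is a congruential t-power mod k:
-- every block sum is congruent to that of the first block.
ContainsCongPower : (k t n : ℕ) → Colouring k → Set
ContainsCongPower k t n χ =
  Σ ℕ λ s → Σ ℕ λ ℓ →
    (1 ≤ ℓ) × (s + t * ℓ ≤ n) ×
    (∀ j → j < t → blockSum χ (s + j * ℓ) ℓ ≡ blockSum χ s ℓ [mod k ])

LProp : (k t n : ℕ) → Set
LProp k t n = (χ : Colouring k) → ContainsCongPower k t n χ

Admissible : (k n : ℕ) → (ℕ → ℕ) → Set
Admissible k n x = ∀ i → 1 ≤ i → i ≤ n → ((i ∸ 1) * k + 1 ≤ x i) × (x i ≤ i * k)

ContainsAP : (m n : ℕ) → (ℕ → ℕ) → Set
ContainsAP m n x =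
  Σ ℕ λ a → Σ ℕ λ d → (1 ≤ d) ×
    (∀ j → j < m → Σ ℕ λ i → (1 ≤ i) × (i ≤ n) × (x i ≡ a + j * d))

ΩProp : (m k n : ℕ) → Set
ΩProp m k n = (x : ℕ → ℕ) → Admissible k n x → ContainsAP m n x

IsMin : (ℕ → Set) → ℕ → Set
IsMin P n = P n × (∀ n′ → P n′ → n ≤ n′)

IsL : (k t n : ℕ) → Set
IsL k t = IsMin (LProp k t)

IsΩ : (m k n : ℕ) → Set
IsΩ m k = IsMin (ΩProp m k)

-- Let K = ⌊k/2⌋ and let x₁, …, x_{L+1} be admissible, x_i ∈ [(i-1)K+1, iK].
-- Colour i ∈ [1,L] by the gap x_{i+1} - x_i, which lies in [1, 2K-1] ⊆ [0, k).
-- A block of ℓ consecutive colours starting after position p then sums to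
-- x_{p+ℓ+1} - x_{p+1}, which lies strictly between (ℓ-1)K and (ℓ+1)K: a window
-- of width 2K ≤ k, so congruent block sums of equal length are equal.  A
-- congruential t-power with blocks of length ℓ starting after s thus makes
-- x_{s+1}, x_{s+ℓ+1}, …, x_{s+tℓ+1} an arithmetic progression of t+1 terms.
-- Hence if every k-colouring of [1,L] contains such a power, Ω(t+1, K) ≤ L+1.
module Submission where

open import Defs
open import Data.Nat using (ℕ; _≤_; _∸_; _/_; suc)
open import Data.Nat as ℕ using (zero; _+_; _*_; _<_; z≤n; s≤s; NonZero)
open import Data.Nat.Properties
open import Data.Nat.DivMod using (_mod_; m<n⇒m%n≡m; m/n*n≤m)
open import Data.Nat.Divisibility using (_∣_; n∣m⇒m%n≡0)
open import Algebra.Properties.CommutativeSemigroup +-commutativeSemigroup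
  using (xy∙z≈xz∙y; x∙yz≈z∙xy; x∙yz≈y∙xz)
open import Data.Fin using (toℕ)
open import Data.Fin.Properties using (toℕ-fromℕ<)
open import Data.Integer as ℤ using (∣_∣)
open import Data.Integer.Properties using ([+m]-[+n]≡m⊖n; ∣⊖∣-≤; ∣i-j∣≡∣j-i∣)
open import Data.Product using (_×_; _,_; proj₁; proj₂)
open import Data.Sum using (inj₁; inj₂)
open import Function using (_∘_)
open import Relation.Binary.PropositionalEquality

n/2+n/2≤n : ∀ n → n / 2 + n / 2 ≤ n
n/2+n/2≤n n = subst (_≤ n) (trans (*-suc (n / 2) 1) (cong (n / 2 +_) (*-identityʳ (n / 2))))
  (m/n*n≤m n 2)

toℕ-mod : ∀ {a k} .{{_ : NonZero k}} → a < k → toℕ (a mod k) ≡ a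
toℕ-mod a<k = trans (toℕ-fromℕ< _) (m<n⇒m%n≡m a<k)

gap-window : ∀ {P K M A S} → P + 1 ≤ A → A ≤ K + P →
  K + M + P + 1 ≤ A + S → A + S ≤ K + (K + M + P) → M < S × S < M + (K + K)
gap-window {P} {K} {M} {A} {S} P+1≤A A≤K+P lower upper =
  +-cancelˡ-< (K + P) M S (begin-strict
    K + P + M          ≡⟨ xy∙z≈xz∙y K P M ⟩
    K + M + P          <⟨ n<1+n _ ⟩
    suc (K + M + P)    ≡⟨ +-comm 1 _ ⟩
    K + M + P + 1      ≤⟨ lower ⟩
    A + S              ≤⟨ +-monoˡ-≤ S A≤K+P ⟩
    K + P + S          ∎) ,
  +-cancelˡ-< P S (M + (K + K)) (begin-strict
    P + S              <⟨ n<1+n _ ⟩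
    suc P + S          ≡⟨ cong (_+ S) (+-comm 1 P) ⟩
    P + 1 + S          ≤⟨ +-monoˡ-≤ S P+1≤A ⟩
    A + S              ≤⟨ upper ⟩
    K + (K + M + P)    ≡⟨ x∙yz≈z∙xy K (K + M) P ⟩
    P + (K + (K + M))  ≡⟨ cong (P +_) (x∙yz≈z∙xy K K M) ⟩
    P + (M + (K + K))  ∎)
  where open ≤-Reasoning

≡[mod]-sym : ∀ {a b k} → a ≡ b [mod k ] → b ≡ a [mod k ]
≡[mod]-sym {a} {b} {k} = subst (k ∣_) (∣i-j∣≡∣j-i∣ (ℤ.+ a) (ℤ.+ b))

≡[mod]⇒≡ : ∀ {a b k} .{{_ : NonZero k}} → a ≤ b → b < a + k → a ≡ b [mod k ] → a ≡ b
≡[mod]⇒≡ {a} {b} {k} a≤b b<a+k a≡b = ≤-antisym a≤b (m∸n≡0⇒m≤n b∸a≡0)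
  where
  k∣b∸a : k ∣ b ∸ a
  k∣b∸a = subst (k ∣_) (trans (cong ∣_∣ ([+m]-[+n]≡m⊖n a b)) (∣⊖∣-≤ a≤b)) a≡b
  b∸a≡0 : b ∸ a ≡ 0
  b∸a≡0 = trans (sym (m<n⇒m%n≡m (m<n+o⇒m∸n<o b a b<a+k))) (n∣m⇒m%n≡0 _ k k∣b∸a)

≡[mod]-window⇒≡ : ∀ {M a b k} .{{_ : NonZero k}} → M < a → a < M + k → M < b → b < M + k →
  a ≡ b [mod k ] → a ≡ b
≡[mod]-window⇒≡ {M} {a} {b} {k} M<a a<M+k M<b b<M+k a≡b with ≤-total a b
... | inj₁ a≤b = ≡[mod]⇒≡ a≤b (<-≤-trans b<M+k (+-monoˡ-≤ k (<⇒≤ M<a))) a≡b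
... | inj₂ b≤a = sym (≡[mod]⇒≡ b≤a (<-≤-trans a<M+k (+-monoˡ-≤ k (<⇒≤ M<b))) (≡[mod]-sym {a} {b} a≡b))

blockSum-telescope : ∀ {k L} (χ : Colouring k) (g : ℕ → ℕ) →
  (∀ {p} → p < L → g p + toℕ (χ (suc p)) ≡ g (suc p)) →
  ∀ p ℓ → ℓ + p ≤ L → g p + blockSum χ p ℓ ≡ g (ℓ + p)
blockSum-telescope χ g step p zero _ = +-identityʳ (g p)
blockSum-telescope {L = L} χ g step p (suc ℓ) fits = begin
  g p + (toℕ (χ (suc p)) + blockSum χ (suc p) ℓ)  ≡⟨ +-assoc (g p) _ _ ⟨
  g p + toℕ (χ (suc p)) + blockSum χ (suc p) ℓ    ≡⟨ cong (_+ blockSum χ (suc p) ℓ) (step p<L) ⟩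
  g (suc p) + blockSum χ (suc p) ℓ                ≡⟨ blockSum-telescope χ g step (suc p) ℓ fits′ ⟩
  g (ℓ + suc p)                                   ≡⟨ cong g (+-suc ℓ p) ⟩
  g (suc ℓ + p)                                   ∎
  where
  open ≡-Reasoning
  p<L : p < L
  p<L = ≤-trans (s≤s (m≤n+m p ℓ)) fits
  fits′ : ℓ + suc p ≤ L
  fits′ = subst (_≤ L) (sym (+-suc ℓ p)) fits

equal-gaps⇒progression : (h : ℕ → ℕ) {d t : ℕ} → (∀ {j} → j < t → h j + d ≡ h (suc j)) →
  ∀ j → j ≤ t → h j ≡ h 0 + j * d
equal-gaps⇒progression h gaps zero _ = sym (+-identityʳ (h 0))
equal-gaps⇒progression h {d} gaps (suc j) j<t = begin
  h (suc j)          ≡⟨ gaps j<t ⟨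
  h j + d            ≡⟨ cong (_+ d) (equal-gaps⇒progression h gaps j (<⇒≤ j<t)) ⟩
  h 0 + j * d + d    ≡⟨ +-assoc (h 0) (j * d) d ⟩
  h 0 + (j * d + d)  ≡⟨ cong (h 0 +_) (+-comm (j * d) d) ⟩
  h 0 + suc j * d    ∎
  where open ≡-Reasoning

module _ {K L : ℕ} {x : ℕ → ℕ} (adm : Admissible K (suc L) x) where

  admissible-increasing : ∀ {p} → p < L → x (suc p) ≤ x (suc (suc p))
  admissible-increasing {p} p<L =
    ≤-trans (proj₂ (adm (suc p) (s≤s z≤n) (s≤s (<⇒≤ p<L))))
      (≤-trans (m≤m+n (K + p * K) 1) (proj₁ (adm (suc (suc p)) (s≤s z≤n) (s≤s p<L))))

  admissible-spread : ∀ {p m S} → suc m + p ≤ L → x (suc p) + S ≡ x (suc (suc m + p)) →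
    m * K < S × S < m * K + (K + K)
  admissible-spread {p} {m} {S} fits eq =
    gap-window (proj₁ start) (proj₂ start)
      (subst₂ _≤_ (cong (_+ 1) dist) (sym eq) (proj₁ end))
      (subst₂ _≤_ (sym eq) (cong (K +_) dist) (proj₂ end))
    where
    start : (p * K + 1 ≤ x (suc p)) × (x (suc p) ≤ K + p * K)
    start = adm (suc p) (s≤s z≤n) (s≤s (≤-trans (m≤n+m p (suc m)) fits))
    end : ((suc m + p) * K + 1 ≤ x (suc (suc m + p))) × (x (suc (suc m + p)) ≤ K + (suc m + p) * K)
    end = adm (suc (suc m + p)) (s≤s z≤n) (s≤s fits)
    dist : (suc m + p) * K ≡ K + m * K + p * K
    dist = *-distribʳ-+ K (suc m) p

-- Reducing mod k only serves to land in Fin k: admissible gaps are already below k.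
differenceColouring : (k : ℕ) .{{_ : NonZero k}} → (ℕ → ℕ) → Colouring k
differenceColouring k x i = (x (suc i) ∸ x i) mod k

module _ (k : ℕ) .{{_ : NonZero k}} {K L : ℕ} (K+K≤k : K + K ≤ k)
         {x : ℕ → ℕ} (adm : Admissible K (suc L) x) where

  private
    χ : Colouring k
    χ = differenceColouring k x

  differenceColouring-step : ∀ {p} → p < L → x (suc p) + toℕ (χ (suc p)) ≡ x (suc (suc p))
  differenceColouring-step {p} p<L = begin
    x (suc p) + toℕ (χ (suc p))                  ≡⟨ cong (x (suc p) +_) (toℕ-mod gap<k) ⟩
    x (suc p) + (x (suc (suc p)) ∸ x (suc p))    ≡⟨ m+[n∸m]≡n increasing ⟩
    x (suc (suc p))                              ∎
    where
    open ≡-Reasoning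
    increasing : x (suc p) ≤ x (suc (suc p))
    increasing = admissible-increasing adm p<L
    gap<k : x (suc (suc p)) ∸ x (suc p) < k
    gap<k = <-≤-trans (proj₂ (admissible-spread adm {m = 0} p<L (m+[n∸m]≡n increasing))) K+K≤k

  blockSum-bounds : ∀ {p m} → suc m + p ≤ L →
    m * K < blockSum χ p (suc m) × blockSum χ p (suc m) < m * K + k
  blockSum-bounds {p} {m} fits with admissible-spread adm fits
    (blockSum-telescope χ (x ∘ suc) differenceColouring-step p (suc m) fits)
  ... | lower , upper = lower , <-≤-trans upper (+-monoʳ-≤ (m * K) K+K≤k)

  congPower⇒AP : ∀ {t} → 1 ≤ t → ContainsCongPower k t L χ → ContainsAP (suc t) (suc L) x
  congPower⇒AP {t} 1≤t (s , suc m , _ , fits , congruent) =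
    x (suc (s + 0)) , d , ≤-trans (s≤s z≤n) (proj₁ first-bounds) ,
    λ j j≤t → suc (s + j * ℓ) , s≤s z≤n , s≤s (start-fits (ℕ.s≤s⁻¹ j≤t)) ,
      equal-gaps⇒progression (λ j → x (suc (s + j * ℓ))) gaps j (ℕ.s≤s⁻¹ j≤t)
    where
    open ≡-Reasoning
    ℓ = suc m
    d = blockSum χ s ℓ
    start-fits : ∀ {j} → j ≤ t → s + j * ℓ ≤ L
    start-fits j≤t = ≤-trans (+-monoʳ-≤ s (*-monoˡ-≤ ℓ j≤t)) fits
    block-end : ∀ j → ℓ + (s + j * ℓ) ≡ s + suc j * ℓ
    block-end j = x∙yz≈y∙xz ℓ s (j * ℓ)
    block-fits : ∀ {j} → j < t → ℓ + (s + j * ℓ) ≤ L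
    block-fits {j} j<t = subst (_≤ L) (sym (block-end j)) (start-fits j<t)
    first-bounds : m * K < d × d < m * K + k
    first-bounds = blockSum-bounds (subst (λ q → ℓ + q ≤ L) (+-identityʳ s) (block-fits 1≤t))
    equal-blockSums : ∀ {j} → j < t → blockSum χ (s + j * ℓ) ℓ ≡ d
    equal-blockSums j<t with blockSum-bounds {m = m} (block-fits j<t)
    ... | lower , upper = ≡[mod]-window⇒≡ lower upper
      (proj₁ first-bounds) (proj₂ first-bounds) (congruent _ j<t)
    gaps : ∀ {j} → j < t → x (suc (s + j * ℓ)) + d ≡ x (suc (s + suc j * ℓ))
    gaps {j} j<t = begin
      x (suc (s + j * ℓ)) + d
        ≡⟨ cong (x (suc (s + j * ℓ)) +_) (equal-blockSums j<t) ⟨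
      x (suc (s + j * ℓ)) + blockSum χ (s + j * ℓ) ℓ
        ≡⟨ blockSum-telescope χ (x ∘ suc) differenceColouring-step _ ℓ (block-fits j<t) ⟩
      x (suc (ℓ + (s + j * ℓ)))
        ≡⟨ cong (x ∘ suc) (block-end j) ⟩
      x (suc (s + suc j * ℓ))
        ∎

lemma14 : (k t : ℕ) → 1 ≤ k → 1 ≤ t →
    (L Ω : ℕ) → IsL k t L → IsΩ (suc t) (k / 2) Ω → Ω ∸ 1 ≤ L
lemma14 zero _ () _ _ _ _ _
lemma14 k@(suc _) t _ 1≤t L Ω (L-works , _) (_ , Ω-minimal) =
  ∸-monoˡ-≤ 1 (Ω-minimal (suc L) λ x adm →
    congPower⇒AP k (n/2+n/2≤n k) adm 1≤t (L-works (differenceColouring k x)))
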